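{- Let $G$ be a finite simple group with a presentation $\langle x_1,\ldots,x_k \mid r_1,\ldots,r_m\rangle$ of length $\ell$, and suppose that every $g\in G$ equals $w(x_1,\ldots,x_k)$ for some word $w$ in the free group on $x_1,\dots,x_k$ of length at most $2^v$. Then there is a first-order sentence $\psi$ in the language of groups expanded by constant symbols for $x_1,\dots,x_k$, of length $O(v+\ell)$ (with a constant independent of $G$), that describes the structure $\langle G, x_1,\ldots,x_k\rangle$, i.e. this structure satisfies $\psi$ and every model of $\psi$ is isomorphic to it.
   Context: The length of a presentation is the total number of symbols needed to write it, i.e. the number of generators plus the total length of the relators; the length of a sentence is its number of symbols. The generators $x_1,\dots,x_k$ are identified with their images in $G$. -}

module Defs where

open import Level using (Level; _⊔_; Lift) renaming (suc to lsuc)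
open import Data.Nat using (ℕ; zero; suc; _+_)
open import Data.Fin using (Fin) renaming (zero to fz; suc to fs)
open import Data.Bool using (Bool; true; false; not)
open import Data.List using (List; []; _∷_; _++_; length; tabulate; foldr)
open import Data.Nat.ListAction using (sum)
open import Data.Product using (Σ; _×_; _,_; ∃-syntax)
open import Data.Sum using (_⊎_)
open import Data.Empty using (⊥)
open import Relation.Binary using (IsEquivalence)
open import Relation.Binary.PropositionalEquality as ≡ using (_≡_)
open import Relation.Nullary using (¬_)
open import Algebra.Bundles using (Group)
open import Function.Bundles using (Inverse)

-- First-order syntax: language of groups {·, ⁻¹, 1} expanded by
-- k constant symbols c₀ … c_{k-1} (for the generators x₁ … x_k).
-- Variables are de Bruijn indices; `Term k n` / `Formula k n` have
-- n variables in scope, so a sentence is a `Formula k 0`.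

data Term (k n : ℕ) : Set where
  var : Fin n → Term k n
  con : Fin k → Term k n
  one : Term k n
  inv : Term k n → Term k n
  mul : Term k n → Term k n → Term k n

data Formula (k : ℕ) : ℕ → Set where
  _≐_  : ∀ {n} → Term k n → Term k n → Formula k n
  falsum : ∀ {n} → Formula k n
  neg  : ∀ {n} → Formula k n → Formula k n
  conj : ∀ {n} → Formula k n → Formula k n → Formula k n
  disj : ∀ {n} → Formula k n → Formula k n → Formula k n
  impl : ∀ {n} → Formula k n → Formula k n → Formula k n
  all  : ∀ {n} → Formula k (suc n) → Formula k n
  ex   : ∀ {n} → Formula k (suc n) → Formula k n

Sentence : ℕ → Set
Sentence k = Formula k 0

-- Length = number of symbols (Polish notation, no parentheses needed);
-- a quantifier counts as two symbols (quantifier + bound variable).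
termLength : ∀ {k n} → Term k n → ℕ
termLength (var _)   = 1
termLength (con _)   = 1
termLength one       = 1
termLength (inv t)   = suc (termLength t)
termLength (mul s t) = suc (termLength s + termLength t)

formulaLength : ∀ {k n} → Formula k n → ℕ
formulaLength (s ≐ t)    = suc (termLength s + termLength t)
formulaLength falsum     = 1
formulaLength (neg φ)    = suc (formulaLength φ)
formulaLength (conj φ ψ) = suc (formulaLength φ + formulaLength ψ)
formulaLength (disj φ ψ) = suc (formulaLength φ + formulaLength ψ)
formulaLength (impl φ ψ) = suc (formulaLength φ + formulaLength ψ)
formulaLength (all φ)    = suc (suc (formulaLength φ))
formulaLength (ex φ)     = suc (suc (formulaLength φ))

-- Structures for this language (setoid-based: the symbol = is
-- interpreted by the equivalence _≈_, which is a congruence).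

record Structure (k : ℕ) (c ℓ : Level) : Set (lsuc (c ⊔ ℓ)) where
  field
    Carrier : Set c
    _≈_     : Carrier → Carrier → Set ℓ
    isEquivalence : IsEquivalence _≈_
    _·_     : Carrier → Carrier → Carrier
    _⁻¹     : Carrier → Carrier
    e       : Carrier
    const   : Fin k → Carrier
    ·-cong  : ∀ {x y u v} → x ≈ y → u ≈ v → (x · u) ≈ (y · v)
    ⁻¹-cong : ∀ {x y} → x ≈ y → (x ⁻¹) ≈ (y ⁻¹)

module _ {k : ℕ} {c ℓ : Level} (M : Structure k c ℓ) where
  open Structure M

  extend : ∀ {n} → Carrier → (Fin n → Carrier) → Fin (suc n) → Carrier
  extend a ρ fz     = a
  extend a ρ (fs i) = ρ i

  ⟦_⟧ : ∀ {n} → Term k n → (Fin n → Carrier) → Carrier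
  ⟦ var i ⟧   ρ = ρ i
  ⟦ con i ⟧   ρ = const i
  ⟦ one ⟧     ρ = e
  ⟦ inv t ⟧   ρ = ⟦ t ⟧ ρ ⁻¹
  ⟦ mul s t ⟧ ρ = ⟦ s ⟧ ρ · ⟦ t ⟧ ρ

  Sat : ∀ {n} → Formula k n → (Fin n → Carrier) → Set (c ⊔ ℓ)
  Sat (s ≐ t)    ρ = Lift c (⟦ s ⟧ ρ ≈ ⟦ t ⟧ ρ)
  Sat falsum     ρ = Lift (c ⊔ ℓ) ⊥
  Sat (neg φ)    ρ = ¬ Sat φ ρ
  Sat (conj φ ψ) ρ = Sat φ ρ × Sat ψ ρ
  Sat (disj φ ψ) ρ = Sat φ ρ ⊎ Sat ψ ρ
  Sat (impl φ ψ) ρ = Sat φ ρ → Sat ψ ρ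
  Sat (all φ)    ρ = (a : Carrier) → Sat φ (extend a ρ)
  Sat (ex φ)     ρ = Σ Carrier (λ a → Sat φ (extend a ρ))

  noVars : Fin 0 → Carrier
  noVars ()

  _⊨_ : Sentence k → Set (c ⊔ ℓ)
  _⊨_ ψ = Sat ψ noVars

record _≅_ {k : ℕ} {c₁ ℓ₁ c₂ ℓ₂ : Level}
           (M : Structure k c₁ ℓ₁) (N : Structure k c₂ ℓ₂)
           : Set (c₁ ⊔ ℓ₁ ⊔ c₂ ⊔ ℓ₂) where
  private
    module M = Structure M
    module N = Structure N
  field
    to        : M.Carrier → N.Carrier
    from      : N.Carrier → M.Carrier
    to-cong   : ∀ {x y} → x M.≈ y → to x N.≈ to y
    from-cong : ∀ {x y} → x N.≈ y → from x M.≈ from y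
    to-from   : ∀ y → to (from y) N.≈ y
    from-to   : ∀ x → from (to x) M.≈ x
    to-·      : ∀ x y → to (x M.· y) N.≈ (to x N.· to y)
    to-⁻¹     : ∀ x → to (x M.⁻¹) N.≈ (to x N.⁻¹)
    to-e      : to M.e N.≈ N.e
    to-const  : ∀ i → to (M.const i) N.≈ N.const i

-- ψ describes M: M ⊨ ψ and every model of ψ is isomorphic to M.
-- (Models are taken in the same universe levels as M.)
Describes : ∀ {k c ℓ} → Structure k c ℓ → Sentence k → Set (lsuc (c ⊔ ℓ))
Describes {k} {c} {ℓ} M ψ =
  (M ⊨ ψ) × ((N : Structure k c ℓ) → N ⊨ ψ → N ≅ M)

module _ {c ℓ : Level} (G : Group c ℓ) where
  open Group G

  groupStructure : ∀ {k} → (Fin k → Carrier) → Structure k c ℓ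
  groupStructure {k} gen = record
    { Carrier = Carrier ; _≈_ = _≈_ ; isEquivalence = isEquivalence
    ; _·_ = _∙_ ; _⁻¹ = _⁻¹ ; e = ε ; const = gen
    ; ·-cong = ∙-cong ; ⁻¹-cong = ⁻¹-cong }

  IsFinite : Set (c ⊔ ℓ)
  IsFinite = ∃[ n ] Inverse setoid (≡.setoid (Fin n))

  record IsNormalSubgroup {p : Level} (P : Carrier → Set p) : Set (c ⊔ ℓ ⊔ p) where
    field
      resp  : ∀ {x y} → x ≈ y → P x → P y
      ε∈    : P ε
      ∙∈    : ∀ {x y} → P x → P y → P (x ∙ y)
      ⁻¹∈   : ∀ {x} → P x → P (x ⁻¹)
      conj∈ : ∀ g {x} → P x → P ((g ∙ x) ∙ (g ⁻¹))

  IsSimple : Set (lsuc (c ⊔ ℓ))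
  IsSimple =
    (∃[ g ] ¬ (g ≈ ε)) ×
    ((P : Carrier → Set (c ⊔ ℓ)) → IsNormalSubgroup P →
       ((∀ x → P x → x ≈ ε) ⊎ (∀ x → P x)))

-- Words in the free group on x₁ … x_k, and presentations.
-- A letter (i , true) is x_i, (i , false) is x_i⁻¹.

Word : ℕ → Set
Word k = List (Fin k × Bool)

module _ {c ℓ : Level} (G : Group c ℓ) {k : ℕ} (gen : Fin k → Group.Carrier G) where
  open Group G

  evalLetter : Fin k × Bool → Carrier
  evalLetter (i , true)  = gen i
  evalLetter (i , false) = gen i ⁻¹

  eval : Word k → Carrier
  eval = foldr (λ a g → evalLetter a ∙ g) ε

-- The congruence on words generated by free cancellation and the
-- relators r_j = 1; words modulo it form the group ⟨x | r⟩.
data Equiv {k m : ℕ} (r : Fin m → Word k) : Word k → Word k → Set where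
  ~refl   : ∀ {u} → Equiv r u u
  ~sym    : ∀ {u v} → Equiv r u v → Equiv r v u
  ~trans  : ∀ {u v w} → Equiv r u v → Equiv r v w → Equiv r u w
  ~cancel : ∀ u v i b → Equiv r (u ++ ((i , b) ∷ (i , not b) ∷ v)) (u ++ v)
  ~rel    : ∀ u v j → Equiv r (u ++ (r j ++ v)) (u ++ v)

-- G = ⟨x₁,…,x_k | r₁,…,r_m⟩ with x_i ↦ gen i: evaluation of words
-- induces an isomorphism from (words / Equiv r) onto G.
record IsPresentation {c ℓ : Level} (G : Group c ℓ) {k m : ℕ}
         (gen : Fin k → Group.Carrier G) (r : Fin m → Word k) : Set (c ⊔ ℓ) where
  open Group G
  field
    surjective : ∀ g → ∃[ w ] (eval G gen w ≈ g)
    sound      : ∀ u v → Equiv r u v → eval G gen u ≈ eval G gen v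
    complete   : ∀ u v → eval G gen u ≈ eval G gen v → Equiv r u v

presentationLength : (k : ℕ) {m : ℕ} → (Fin m → Word k) → ℕ
presentationLength k {m} r = k + sum (tabulate {n = m} (λ j → length (r j)))

module Submission where

-- The sentence ψ is the conjunction of four clauses:
--   * the group axioms;
--   * ∀y. φ_v(y), where φ_v(y) says that y is a product of at most 2^v
--     generators and inverses of generators.  It is defined by
--       φ_0(y)     :=  y = 1 ∨ y = x_i ∨ y = x_i⁻¹ (some i),
--       φ_{j+1}(y) :=  ∃a ∃b. y = a·b ∧ ∀z. (z = a ∨ z = b) → φ_j(z),
--     so φ_j occurs only once in φ_{j+1} and |φ_v| is linear in v;
--   * r_j = 1 for every relator (length linear in the relator);
--   * ∃y. y ≠ 1.
-- G satisfies ψ.  Conversely a model N of ψ is a group generated by the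
-- constants in which the relators hold; so every relation between the
-- generators of G also holds in N (von Dyck).  The words dying in N form a
-- normal subgroup of G, which by simplicity of G is trivial (it cannot be all
-- of G since N is nontrivial).  Hence words evaluate to equal elements in N
-- exactly when they do in G, which yields N ≅ ⟨G, x₁,…,x_k⟩.

open import Defs
open import Level using (Level; Lift; lift; lower; _⊔_)
open import Data.Nat using (ℕ; zero; suc; _+_; _*_; _^_; _≤_; z≤n; s≤s)
open import Data.Nat.Properties
  using (≤-refl; ≤-trans; ≤-reflexive; n≤1+n; m≤m+n; m⊓n≤m; m≤n+o⇒m∸n≤o;
         +-identityʳ; +-comm; +-mono-≤; +-monoˡ-≤; +-monoʳ-≤; *-monoʳ-≤; module ≤-Reasoning)
open import Data.Nat.Tactic.RingSolver using (solve-∀)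
open import Data.Fin using (Fin) renaming (zero to fz; suc to fs)
open import Data.Bool using (Bool; true; false; not)
open import Data.List using ([]; _∷_; _++_; length; tabulate; take; drop)
open import Data.List.Properties using (length-take; length-drop; take++drop≡id; ++-identityʳ)
open import Data.Nat.ListAction using (sum)
open import Data.Product using (_×_; _,_; proj₁; proj₂; ∃-syntax)
open import Data.Sum using (inj₁; inj₂)
open import Data.Empty using (⊥-elim)
open import Relation.Nullary using (¬_)
open import Relation.Binary.PropositionalEquality as ≡ using (_≡_)
open import Function using (_∘_; id)
open import Algebra.Bundles using (Group)
import Algebra.Properties.Group as GroupProperties
import Relation.Binary.Reasoning.Setoid as SetoidReasoning

inverseLetter : ∀ {k} → Fin k × Bool → Fin k × Bool
inverseLetter (i , b) = (i , not b)

inverseWord : ∀ {k} → Word k → Word k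
inverseWord []      = []
inverseWord (l ∷ w) = inverseWord w ++ (inverseLetter l ∷ [])

module WordEvaluation {c ℓ : Level} (H : Group c ℓ) {k : ℕ}
                      (h : Fin k → Group.Carrier H) where
  open Group H
  open GroupProperties H
  open SetoidReasoning setoid

  ev : Word k → Carrier
  ev = eval H h

  evL : Fin k × Bool → Carrier
  evL = evalLetter H h

  eval-++ : ∀ u w → ev (u ++ w) ≈ ev u ∙ ev w
  eval-++ []      w = sym (identityˡ _)
  eval-++ (l ∷ u) w = begin
    evL l ∙ ev (u ++ w)   ≈⟨ ∙-cong refl (eval-++ u w) ⟩
    evL l ∙ (ev u ∙ ev w) ≈⟨ sym (assoc _ _ _) ⟩
    (evL l ∙ ev u) ∙ ev w ∎

  eval-single : ∀ i → ev ((i , true) ∷ []) ≈ h i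
  eval-single i = identityʳ (h i)

  evalLetter-inverse : ∀ l → evL (inverseLetter l) ≈ evL l ⁻¹
  evalLetter-inverse (i , true)  = refl
  evalLetter-inverse (i , false) = sym (⁻¹-involutive _)

  eval-inverseWord : ∀ w → ev (inverseWord w) ≈ ev w ⁻¹
  eval-inverseWord []      = sym ε⁻¹≈ε
  eval-inverseWord (l ∷ w) = begin
    ev (inverseWord w ++ (inverseLetter l ∷ []))  ≈⟨ eval-++ (inverseWord w) _ ⟩
    ev (inverseWord w) ∙ (evL (inverseLetter l) ∙ ε)
      ≈⟨ ∙-cong (eval-inverseWord w) (trans (identityʳ _) (evalLetter-inverse l)) ⟩
    ev w ⁻¹ ∙ evL l ⁻¹                            ≈⟨ sym (⁻¹-anti-homo-∙ _ _) ⟩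
    (evL l ∙ ev w) ⁻¹                             ∎

  eval-quotient : ∀ u w → ev (u ++ inverseWord w) ≈ ev u ∙ ev w ⁻¹
  eval-quotient u w = trans (eval-++ u _) (∙-cong refl (eval-inverseWord w))

  eval-conjugate : ∀ u w → ev ((u ++ w) ++ inverseWord u) ≈ (ev u ∙ ev w) ∙ ev u ⁻¹
  eval-conjugate u w = trans (eval-quotient (u ++ w) u) (∙-cong (eval-++ u w) refl)

  cancelLetter : ∀ l x → evL l ∙ (evL (inverseLetter l) ∙ x) ≈ x
  cancelLetter l x = begin
    evL l ∙ (evL (inverseLetter l) ∙ x) ≈⟨ ∙-cong refl (∙-cong (evalLetter-inverse l) refl) ⟩
    evL l ∙ (evL l ⁻¹ ∙ x)              ≈⟨ sym (assoc _ _ _) ⟩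
    (evL l ∙ evL l ⁻¹) ∙ x              ≈⟨ ∙-cong (inverseʳ _) refl ⟩
    ε ∙ x                               ≈⟨ identityˡ x ⟩
    x                                   ∎

  eval-respects-Equiv : ∀ {m} (r : Fin m → Word k) → (∀ j → ev (r j) ≈ ε) →
                        ∀ {u w} → Equiv r u w → ev u ≈ ev w
  eval-respects-Equiv r rel ~refl          = refl
  eval-respects-Equiv r rel (~sym e)       = sym (eval-respects-Equiv r rel e)
  eval-respects-Equiv r rel (~trans e e′)  =
    trans (eval-respects-Equiv r rel e) (eval-respects-Equiv r rel e′)
  eval-respects-Equiv r rel (~cancel u w i b) = begin
    ev (u ++ ((i , b) ∷ (i , not b) ∷ w))      ≈⟨ eval-++ u _ ⟩
    ev u ∙ (evL (i , b) ∙ (evL (i , not b) ∙ ev w)) ≈⟨ ∙-cong refl (cancelLetter (i , b) (ev w)) ⟩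
    ev u ∙ ev w                                ≈⟨ sym (eval-++ u w) ⟩
    ev (u ++ w)                                ∎
  eval-respects-Equiv r rel (~rel u w j) = begin
    ev (u ++ (r j ++ w))       ≈⟨ eval-++ u _ ⟩
    ev u ∙ ev (r j ++ w)       ≈⟨ ∙-cong refl (eval-++ (r j) w) ⟩
    ev u ∙ (ev (r j) ∙ ev w)   ≈⟨ ∙-cong refl (trans (∙-cong (rel j) refl) (identityˡ _)) ⟩
    ev u ∙ ev w                ≈⟨ sym (eval-++ u w) ⟩
    ev (u ++ w)                ∎

generators-nonempty : ∀ {c ℓ} (H : Group c ℓ) {k} (h : Fin k → Group.Carrier H) →
  (∃[ y ] ¬ Group._≈_ H y (Group.ε H)) → (∀ y → ∃[ w ] Group._≈_ H (eval H h w) y) → 1 ≤ k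
generators-nonempty H {suc k} h nontrivial generated = s≤s z≤n
generators-nonempty H {zero}  h (y , y≉ε) generated with generated y
... | [] , ε≈y = ⊥-elim (y≉ε (Group.sym H ε≈y))
... | ((() , _) ∷ _) , _

-- Two generated groups in which the same pairs of words evaluate to equal
-- elements are isomorphic as structures with constants: match the values of
-- each word.
module SameWordRelations {c₁ ℓ₁ c₂ ℓ₂ : Level} {k : ℕ}
    (H : Group c₁ ℓ₁) (h : Fin k → Group.Carrier H)
    (G : Group c₂ ℓ₂) (g : Fin k → Group.Carrier G)
    (H-generated : ∀ y → ∃[ w ] Group._≈_ H (eval H h w) y)
    (G-generated : ∀ x → ∃[ w ] Group._≈_ G (eval G g w) x)
    (H⇒G : ∀ u w → Group._≈_ H (eval H h u) (eval H h w) → Group._≈_ G (eval G g u) (eval G g w))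
    (G⇒H : ∀ u w → Group._≈_ G (eval G g u) (eval G g w) → Group._≈_ H (eval H h u) (eval H h w))
    where
  module H = Group H
  module G = Group G
  module EH = WordEvaluation H h
  module EG = WordEvaluation G g

  wordOf : H.Carrier → Word k
  wordOf y = proj₁ (H-generated y)

  to : H.Carrier → G.Carrier
  to y = EG.ev (wordOf y)

  from : G.Carrier → H.Carrier
  from x = EH.ev (proj₁ (G-generated x))

  to-eval : ∀ y u → EH.ev u H.≈ y → to y G.≈ EG.ev u
  to-eval y u u≈y = H⇒G (wordOf y) u (H.trans (proj₂ (H-generated y)) (H.sym u≈y))

  from-eval : ∀ x u → EG.ev u G.≈ x → from x H.≈ EH.ev u
  from-eval x u u≈x = G⇒H (proj₁ (G-generated x)) u (G.trans (proj₂ (G-generated x)) (G.sym u≈x))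

  isomorphism : groupStructure H h ≅ groupStructure G g
  isomorphism = record
    { to        = to
    ; from      = from
    ; to-cong   = λ {y} {y′} y≈y′ →
        G.sym (to-eval y′ (wordOf y) (H.trans (proj₂ (H-generated y)) y≈y′))
    ; from-cong = λ {x} {x′} x≈x′ →
        from-eval x (proj₁ (G-generated x′)) (G.trans (proj₂ (G-generated x′)) (G.sym x≈x′))
    ; to-from   = λ x → G.trans (to-eval _ (proj₁ (G-generated x)) H.refl) (proj₂ (G-generated x))
    ; from-to   = λ y → H.trans (from-eval _ (wordOf y) G.refl) (proj₂ (H-generated y))
    ; to-·      = λ y y′ → G.trans
        (to-eval (y H.∙ y′) (wordOf y ++ wordOf y′)
          (H.trans (EH.eval-++ (wordOf y) _) (H.∙-cong (proj₂ (H-generated y)) (proj₂ (H-generated y′)))))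
        (EG.eval-++ (wordOf y) (wordOf y′))
    ; to-⁻¹     = λ y → G.trans
        (to-eval (y H.⁻¹) (inverseWord (wordOf y))
          (H.trans (EH.eval-inverseWord (wordOf y)) (H.⁻¹-cong (proj₂ (H-generated y)))))
        (EG.eval-inverseWord (wordOf y))
    ; to-e      = to-eval H.ε [] H.refl
    ; to-const  = λ i → G.trans (to-eval (h i) ((i , true) ∷ []) (EH.eval-single i)) (EG.eval-single i)
    }

module SimpleQuotient {c ℓ : Level} (G : Group c ℓ) {k m : ℕ}
    (gen : Fin k → Group.Carrier G) (r : Fin m → Word k)
    (pres : IsPresentation G gen r) (simple : IsSimple G)
    (H : Group c ℓ) (h : Fin k → Group.Carrier H)
    (relators : ∀ j → Group._≈_ H (eval H h (r j)) (Group.ε H))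
    where
  module G = Group G
  module H = Group H
  module EG = WordEvaluation G gen
  module EH = WordEvaluation H h
  open IsPresentation pres

  vonDyck : ∀ u w → EG.ev u G.≈ EG.ev w → EH.ev u H.≈ EH.ev w
  vonDyck u w u≈w = EH.eval-respects-Equiv r relators (complete u w u≈w)

  Kernel : G.Carrier → Set (c ⊔ ℓ)
  Kernel x = Lift c (∃[ w ] (EG.ev w G.≈ x × EH.ev w H.≈ H.ε))

  kernel-normal : IsNormalSubgroup G Kernel
  kernel-normal = record
    { resp  = λ x≈y (lift (w , w≈x , w≈ε)) → lift (w , G.trans w≈x x≈y , w≈ε)
    ; ε∈    = lift ([] , G.refl , H.refl)
    ; ∙∈    = λ (lift (u , u≈x , u≈ε)) (lift (w , w≈y , w≈ε)) → lift (u ++ w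
              , G.trans (EG.eval-++ u w) (G.∙-cong u≈x w≈y)
              , H.trans (EH.eval-++ u w) (H.trans (H.∙-cong u≈ε w≈ε) (H.identityˡ H.ε)))
    ; ⁻¹∈   = λ (lift (w , w≈x , w≈ε)) → lift (inverseWord w
              , G.trans (EG.eval-inverseWord w) (G.⁻¹-cong w≈x)
              , H.trans (EH.eval-inverseWord w) (H.trans (H.⁻¹-cong w≈ε) (GroupProperties.ε⁻¹≈ε H)))
    ; conj∈ = λ x (lift (w , w≈y , w≈ε)) → conjugate x w w≈y w≈ε
    }
    where
    conjugate : ∀ x {y} w → EG.ev w G.≈ y → EH.ev w H.≈ H.ε → Kernel ((x G.∙ y) G.∙ x G.⁻¹)
    conjugate x w w≈y w≈ε = lift (((u ++ w) ++ inverseWord u)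
      , G.trans (EG.eval-conjugate u w) (G.∙-cong (G.∙-cong u≈x w≈y) (G.⁻¹-cong u≈x))
      , H.trans (EH.eval-conjugate u w)
          (H.trans (H.∙-cong (H.trans (H.∙-cong H.refl w≈ε) (H.identityʳ _)) H.refl) (H.inverseʳ _)))
      where
      u = proj₁ (surjective x)
      u≈x = proj₂ (surjective x)

  faithful : (∃[ y ] ¬ (y H.≈ H.ε)) → (∀ y → ∃[ w ] (EH.ev w H.≈ y)) →
             ∀ u w → EH.ev u H.≈ EH.ev w → EG.ev u G.≈ EG.ev w
  faithful (y , y≉ε) generated u w u≈w with proj₂ simple Kernel kernel-normal
  ... | inj₁ trivial = GroupProperties.x∙y⁻¹≈ε⇒x≈y G _ _
          (G.trans (G.sym (EG.eval-quotient u w))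
                   (trivial _ (lift (u ++ inverseWord w , G.refl , quotient≈ε))))
    where
    quotient≈ε : EH.ev (u ++ inverseWord w) H.≈ H.ε
    quotient≈ε = H.trans (EH.eval-quotient u w)
                   (H.trans (H.∙-cong u≈w H.refl) (H.inverseʳ _))
  ... | inj₂ everything with generated y
  ...   | wy , wy≈y with lower (everything (EG.ev wy))
  ...     | w′ , w′≈wy , w′≈ε =
    ⊥-elim (y≉ε (H.trans (H.sym wy≈y) (H.trans (H.sym (vonDyck w′ wy w′≈wy)) w′≈ε)))

  isomorphism : (∃[ y ] ¬ (y H.≈ H.ε)) → (∀ y → ∃[ w ] (EH.ev w H.≈ y)) →
                groupStructure H h ≅ groupStructure G gen
  isomorphism nontrivial generated =
    SameWordRelations.isomorphism H h G gen generated surjective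
      (faithful nontrivial generated) vonDyck

v0 : ∀ {k n} → Term k (suc n)
v0 = var fz

v1 : ∀ {k n} → Term k (suc (suc n))
v1 = var (fs fz)

v2 : ∀ {k n} → Term k (suc (suc (suc n)))
v2 = var (fs (fs fz))

letterTerm : ∀ {k n} → Fin k × Bool → Term k n
letterTerm (i , true)  = con i
letterTerm (i , false) = inv (con i)

wordTerm : ∀ {k n} → Word k → Term k n
wordTerm []      = one
wordTerm (l ∷ w) = mul (letterTerm l) (wordTerm w)

isLetterAmong : ∀ {k n} (k′ : ℕ) → (Fin k′ → Fin k) → Formula k (suc n)
isLetterAmong zero     f = falsum
isLetterAmong (suc k′) f =
  disj (disj (v0 ≐ letterTerm (f fz , true)) (v0 ≐ letterTerm (f fz , false)))
       (isLetterAmong k′ (f ∘ fs))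

-- φ_j: "v0 is a product of at most 2^j letters".
generatedWithin : ∀ {k} (j : ℕ) {n : ℕ} → Formula k (suc n)
generatedWithin {k} zero = disj (v0 ≐ one) (isLetterAmong k id)
generatedWithin (suc j)  =
  ex (ex (conj (v2 ≐ mul v1 v0)
     (all (impl (disj (v0 ≐ v2) (v0 ≐ v1)) (generatedWithin j)))))

-- "w = 1", omitted for the empty word so that its length is O(|w|).
relatorClause : ∀ {k} → Word k → Sentence k → Sentence k
relatorClause []      ψ = ψ
relatorClause (l ∷ w) ψ = conj (wordTerm (l ∷ w) ≐ one) ψ

relatorsHold : ∀ {k} (m : ℕ) → (Fin m → Word k) → Sentence k
relatorsHold zero    r = neg falsum
relatorsHold (suc m) r = relatorClause (r fz) (relatorsHold m (r ∘ fs))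

groupAxioms : ∀ {k} → Sentence k
groupAxioms = conj (all (all (all (mul (mul v2 v1) v0 ≐ mul v2 (mul v1 v0)))))
              (conj (all (mul one v0 ≐ v0))
              (conj (all (mul v0 one ≐ v0))
              (conj (all (mul (inv v0) v0 ≐ one))
                    (all (mul v0 (inv v0) ≐ one)))))

nontrivial : ∀ {k} → Sentence k
nontrivial = ex (neg (v0 ≐ one))

describingSentence : ∀ {k} (m : ℕ) → (Fin m → Word k) → ℕ → Sentence k
describingSentence m r v =
  conj groupAxioms (conj (all (generatedWithin v)) (conj (relatorsHold m r) nontrivial))

isLetterAmong-length : ∀ {k n} k′ (f : Fin k′ → Fin k) →
  formulaLength (isLetterAmong {k} {n} k′ f) ≡ suc (k′ * 9)
isLetterAmong-length zero f = ≡.refl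
isLetterAmong-length {k} {n} (suc k′) f rewrite isLetterAmong-length {k} {n} k′ (f ∘ fs) = ≡.refl

generatedWithin-length : ∀ {k} j {n} →
  formulaLength (generatedWithin {k} j {n}) ≡ j * 20 + (5 + k * 9)
generatedWithin-length {k} zero {n} rewrite isLetterAmong-length {k} {n} k id = ≡.refl
generatedWithin-length {k} (suc j) {n} rewrite generatedWithin-length {k} j {suc (suc (suc n))} = ≡.refl

wordTerm-length : ∀ {k n} (w : Word k) → termLength (wordTerm {k} {n} w) ≤ suc (length w * 3)
wordTerm-length []               = ≤-refl
wordTerm-length ((i , true) ∷ w)  = s≤s (s≤s (≤-trans (wordTerm-length w) (n≤1+n _)))
wordTerm-length ((i , false) ∷ w) = s≤s (s≤s (s≤s (wordTerm-length w)))

relatorClause-length : ∀ {k} (w : Word k) ψ →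
  formulaLength (relatorClause w ψ) ≤ length w * 7 + formulaLength ψ
relatorClause-length []      ψ = ≤-refl
relatorClause-length (l ∷ w) ψ = +-monoˡ-≤ (formulaLength ψ) (equation (wordTerm-length (l ∷ w)))
  where
  equation : ∀ {t} → t ≤ suc (suc (length w) * 3) → suc (suc (t + 1)) ≤ suc (length w) * 7
  equation {t} t≤ = begin
    suc (suc (t + 1))        ≡⟨ ≡.cong (suc ∘ suc) (+-comm t 1) ⟩
    3 + t                    ≤⟨ +-monoʳ-≤ 3 t≤ ⟩
    7 + length w * 3         ≤⟨ +-monoʳ-≤ 7 (*-monoʳ-≤ (length w) (s≤s (s≤s (s≤s z≤n)))) ⟩
    suc (length w) * 7       ∎
    where open ≤-Reasoning

relatorsHold-length : ∀ {k} m (r : Fin m → Word k) →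
  formulaLength (relatorsHold m r) ≤ sum (tabulate (λ j → length (r j))) * 7 + 2
relatorsHold-length zero    r = ≤-refl
relatorsHold-length (suc m) r = begin
  formulaLength (relatorsHold (suc m) r)                ≤⟨ relatorClause-length (r fz) _ ⟩
  length (r fz) * 7 + formulaLength (relatorsHold m (r ∘ fs))
                                                        ≤⟨ +-monoʳ-≤ _ (relatorsHold-length m (r ∘ fs)) ⟩
  length (r fz) * 7 + (S * 7 + 2)                       ≡⟨ distribute (length (r fz)) S ⟩
  (length (r fz) + S) * 7 + 2                           ∎
  where
  open ≤-Reasoning
  S = sum (tabulate (λ j → length (r (fs j))))
  distribute : ∀ a b → a * 7 + (b * 7 + 2) ≡ (a + b) * 7 + 2
  distribute = solve-∀

describingSentence-length : ∀ {k} m (r : Fin m → Word k) v → 1 ≤ k →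
  formulaLength (describingSentence m r v) ≤ 78 * (v + presentationLength k r)
describingSentence-length {suc k′} m r v _ = begin
  formulaLength (describingSentence m r v)  ≡⟨ unfold Φ R ⟩
  62 + Φ + R                                ≤⟨ +-mono-≤ (≤-reflexive (≡.cong (62 +_) (generatedWithin-length v)))
                                                         (relatorsHold-length m r) ⟩
  62 + (v * 20 + (5 + suc k′ * 9)) + (S * 7 + 2)
                                            ≤⟨ m≤m+n _ _ ⟩
  62 + (v * 20 + (5 + suc k′ * 9)) + (S * 7 + 2) + (v * 58 + k′ * 69 + S * 71)
                                            ≡⟨ collect v k′ S ⟩
  78 * (v + (suc k′ + S))                   ∎
  where
  open ≤-Reasoning
  Φ = formulaLength (generatedWithin {suc k′} v {0})
  R = formulaLength (relatorsHold m r)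
  S = sum (tabulate (λ j → length (r j)))
  unfold : ∀ Φ R → suc (51 + suc (suc (suc Φ) + suc (R + 6))) ≡ 62 + Φ + R
  unfold = solve-∀
  collect : ∀ v k′ S → 62 + (v * 20 + (5 + suc k′ * 9)) + (S * 7 + 2) + (v * 58 + k′ * 69 + S * 71)
                       ≡ 78 * (v + (suc k′ + S))
  collect = solve-∀

halve : ∀ {k} j (w : Word k) → length w ≤ 2 ^ suc j →
        ∃[ u ] ∃[ t ] (u ++ t ≡ w × length u ≤ 2 ^ j × length t ≤ 2 ^ j)
halve j w |w|≤ = take (2 ^ j) w , drop (2 ^ j) w , take++drop≡id (2 ^ j) w
  , ≡.subst (_≤ 2 ^ j) (≡.sym (length-take (2 ^ j) w)) (m⊓n≤m _ _)
  , ≡.subst (_≤ 2 ^ j) (≡.sym (length-drop (2 ^ j) w))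
      (m≤n+o⇒m∸n≤o (length w) (2 ^ j)
        (≡.subst (length w ≤_) (≡.cong (2 ^ j +_) (+-identityʳ (2 ^ j))) |w|≤))

module Semantics {c ℓ : Level} (H : Group c ℓ) {k : ℕ} (h : Fin k → Group.Carrier H) where
  open Group H
  open WordEvaluation H h
  M = groupStructure H h

  wordTerm-meaning : ∀ {n} (ρ : Fin n → Carrier) w → ⟦_⟧ M (wordTerm w) ρ ≡ ev w
  wordTerm-meaning ρ []               = ≡.refl
  wordTerm-meaning ρ ((i , true) ∷ w)  = ≡.cong (h i ∙_) (wordTerm-meaning ρ w)
  wordTerm-meaning ρ ((i , false) ∷ w) = ≡.cong (h i ⁻¹ ∙_) (wordTerm-meaning ρ w)

  isLetterAmong-complete : ∀ {n} k′ (f : Fin k′ → Fin k) t b (ρ : Fin n → Carrier) y →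
    y ≈ evL (f t , b) → Sat M (isLetterAmong k′ f) (extend M y ρ)
  isLetterAmong-complete (suc k′) f fz     true  ρ y e = inj₁ (inj₁ (lift e))
  isLetterAmong-complete (suc k′) f fz     false ρ y e = inj₁ (inj₂ (lift e))
  isLetterAmong-complete (suc k′) f (fs t) b     ρ y e =
    inj₂ (isLetterAmong-complete k′ (f ∘ fs) t b ρ y e)

  isLetterAmong-sound : ∀ {n} k′ (f : Fin k′ → Fin k) (ρ : Fin n → Carrier) y →
    Sat M (isLetterAmong k′ f) (extend M y ρ) → ∃[ l ] (y ≈ evL l)
  isLetterAmong-sound (suc k′) f ρ y (inj₁ (inj₁ (lift e))) = (f fz , true) , e
  isLetterAmong-sound (suc k′) f ρ y (inj₁ (inj₂ (lift e))) = (f fz , false) , e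
  isLetterAmong-sound (suc k′) f ρ y (inj₂ s) = isLetterAmong-sound k′ (f ∘ fs) ρ y s

  generatedWithin-complete : ∀ j {n} (ρ : Fin n → Carrier) y w →
    length w ≤ 2 ^ j → ev w ≈ y → Sat M (generatedWithin j) (extend M y ρ)
  generatedWithin-complete zero ρ y []      _ e = inj₁ (lift (sym e))
  generatedWithin-complete zero ρ y (l ∷ []) _ e =
    inj₂ (isLetterAmong-complete k id (proj₁ l) (proj₂ l) ρ y (trans (sym e) (identityʳ _)))
  generatedWithin-complete zero ρ y (_ ∷ _ ∷ _) (s≤s ()) e
  generatedWithin-complete (suc j) ρ y w |w|≤ e with halve j w |w|≤
  ... | u , t , ≡.refl , |u|≤ , |t|≤ =
    ev u , ev t , lift (trans (sym e) (eval-++ u t)) , λ where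
      z (inj₁ (lift z≈u)) → generatedWithin-complete j _ z u |u|≤ (sym z≈u)
      z (inj₂ (lift z≈t)) → generatedWithin-complete j _ z t |t|≤ (sym z≈t)

  generatedWithin-sound : ∀ j {n} (ρ : Fin n → Carrier) y →
    Sat M (generatedWithin j) (extend M y ρ) → ∃[ w ] (ev w ≈ y)
  generatedWithin-sound zero ρ y (inj₁ (lift y≈ε)) = [] , sym y≈ε
  generatedWithin-sound zero ρ y (inj₂ s) with isLetterAmong-sound k id ρ y s
  ... | l , y≈l = (l ∷ []) , trans (identityʳ _) (sym y≈l)
  generatedWithin-sound (suc j) ρ y (a , b , lift y≈ab , φ-ab)
    with generatedWithin-sound j _ a (φ-ab a (inj₁ (lift refl)))
       | generatedWithin-sound j _ b (φ-ab b (inj₂ (lift refl)))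
  ... | u , u≈a | t , t≈b = u ++ t , trans (eval-++ u t) (trans (∙-cong u≈a t≈b) (sym y≈ab))

  relatorClause-meaning : ∀ w ψ → M ⊨ relatorClause w ψ → (ev w ≈ ε) × (M ⊨ ψ)
  relatorClause-meaning []      ψ s = refl , s
  relatorClause-meaning (l ∷ w) ψ (lift e , s) =
    trans (reflexive (≡.sym (wordTerm-meaning _ (l ∷ w)))) e , s

  relatorClause-intro : ∀ w ψ → ev w ≈ ε → M ⊨ ψ → M ⊨ relatorClause w ψ
  relatorClause-intro []      ψ e s = s
  relatorClause-intro (l ∷ w) ψ e s = lift (trans (reflexive (wordTerm-meaning _ (l ∷ w))) e) , s

  relatorsHold-sound : ∀ m (r : Fin m → Word k) → M ⊨ relatorsHold m r → ∀ j → ev (r j) ≈ ε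
  relatorsHold-sound (suc m) r s fz     = proj₁ (relatorClause-meaning (r fz) _ s)
  relatorsHold-sound (suc m) r s (fs j) =
    relatorsHold-sound m (r ∘ fs) (proj₂ (relatorClause-meaning (r fz) _ s)) j

  relatorsHold-complete : ∀ m (r : Fin m → Word k) → (∀ j → ev (r j) ≈ ε) → M ⊨ relatorsHold m r
  relatorsHold-complete zero    r rel = λ ()
  relatorsHold-complete (suc m) r rel =
    relatorClause-intro (r fz) _ (rel fz) (relatorsHold-complete m (r ∘ fs) (rel ∘ fs))

  groupAxioms-hold : M ⊨ groupAxioms
  groupAxioms-hold = (λ x y z → lift (assoc x y z)) , (λ x → lift (identityˡ x))
    , (λ x → lift (identityʳ x)) , (λ x → lift (inverseˡ x)) , (λ x → lift (inverseʳ x))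

-- A model of the group axioms is a group; re-reading it as a structure with
-- its own constants gives back the model definitionally.
modelGroup : ∀ {k c ℓ} (N : Structure k c ℓ) → N ⊨ groupAxioms → Group c ℓ
modelGroup N (assoc , identityˡ , identityʳ , inverseˡ , inverseʳ) = record
  { Carrier = Carrier ; _≈_ = _≈_ ; _∙_ = _·_ ; ε = e ; _⁻¹ = _⁻¹
  ; isGroup = record
    { isMonoid = record
      { isSemigroup = record
        { isMagma = record { isEquivalence = isEquivalence ; ∙-cong = ·-cong }
        ; assoc   = λ x y z → lower (assoc x y z) }
      ; identity = (λ x → lower (identityˡ x)) , (λ x → lower (identityʳ x)) }
    ; inverse = (λ x → lower (inverseˡ x)) , (λ x → lower (inverseʳ x))
    ; ⁻¹-cong = ⁻¹-cong } }
  where open Structure N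

satisfies : ∀ {c ℓ} (G : Group c ℓ) {k m} (gen : Fin k → Group.Carrier G)
  (r : Fin m → Word k) (v : ℕ) → IsSimple G → IsPresentation G gen r →
  (∀ g → ∃[ w ] (length w ≤ 2 ^ v × Group._≈_ G (eval G gen w) g)) →
  groupStructure G gen ⊨ describingSentence m r v
satisfies G gen r v ((g , g≉ε) , _) pres short =
  groupAxioms-hold
  , (λ y → generatedWithin-complete v _ y (proj₁ (short y)) (proj₁ (proj₂ (short y))) (proj₂ (proj₂ (short y))))
  , relatorsHold-complete _ r relatorEvaluatesToε
  , g , λ (lift g≈ε) → g≉ε g≈ε
  where
  open Group G
  open Semantics G gen
  relatorEvaluatesToε : ∀ j → eval G gen (r j) ≈ ε
  relatorEvaluatesToε j = trans (reflexive (≡.cong (eval G gen) (≡.sym (++-identityʳ (r j)))))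
                                (IsPresentation.sound pres (r j ++ []) [] (~rel [] [] j))

modelsAreIsomorphic : ∀ {c ℓ} (G : Group c ℓ) {k m} (gen : Fin k → Group.Carrier G)
  (r : Fin m → Word k) (v : ℕ) → IsSimple G → IsPresentation G gen r →
  (N : Structure k c ℓ) → N ⊨ describingSentence m r v → N ≅ groupStructure G gen
modelsAreIsomorphic G gen r v simple pres N (axioms , generated , relators , y , y≉ε) =
  SimpleQuotient.isomorphism G gen r pres simple H (Structure.const N)
    (relatorsHold-sound _ r relators)
    (y , λ y≈ε → y≉ε (lift y≈ε))
    (λ z → generatedWithin-sound v _ z (generated z))
  where
  H = modelGroup N axioms
  open Semantics H (Structure.const N)

mainTheorem11 : ∀ {c ℓ : Level} → ∃[ C ]
    ((G : Group c ℓ) (k m : ℕ) (gen : Fin k → Group.Carrier G)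
     (r : Fin m → Word k) (v : ℕ) →
     IsFinite G → IsSimple G → IsPresentation G gen r →
     (∀ g → ∃[ w ] (length w ≤ 2 ^ v × Group._≈_ G (eval G gen w) g)) →
     ∃[ ψ ] (formulaLength ψ ≤ C * (v + presentationLength k r)
             × Describes (groupStructure G gen) ψ))
mainTheorem11 = 78 , λ G k m gen r v _ simple pres short →
  describingSentence m r v
  , describingSentence-length m r v
      (generators-nonempty G gen (proj₁ simple) (λ g → proj₁ (short g) , proj₂ (proj₂ (short g))))
  , satisfies G gen r v simple pres short
  , modelsAreIsomorphic G gen r v simple pres
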